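{- Let $r\ge3$ and $1<s\le r$ be integers and let $a_1,\dots,a_r\in\Omega$ be defined recursively by $a_1=(a_r,\mathrm{id})\sigma$, $a_i=(\mathrm{id},a_{i-1})$ for $2\le i\le s-1$, $a_s=(\mathrm{id},a_{s-1})\sigma$, $a_i=(a_{i-1},\mathrm{id})$ for $s+1\le i\le r$. Then $a_1a_2\cdots a_r=\mathrm{id}$ in $\Omega$.
   Context: $T$ is the regular rooted binary tree whose vertices are finite words over $\{0,1\}$; $\Omega=\mathrm{Aut}(T)$; automorphisms act on the right and $\gamma\gamma'$ means first $\gamma$ then $\gamma'$. Every $\gamma\in\Omega$ is written uniquely as $(\gamma_0,\gamma_1)\tau$ with $\tau\in\{\mathrm{id},\sigma\}$, meaning $(xv)\gamma=(x)\tau\,(v)\gamma_x$ for a letter $x$ and word $v$; $\sigma=(\mathrm{id},\mathrm{id})\sigma$ swaps the first letter. Multiplication: $(\gamma_0,\gamma_1)\tau\cdot(\gamma_0',\gamma_1')\tau'=(\gamma_0\gamma'_{(0)\tau},\gamma_1\gamma'_{(1)\tau})\tau\tau'$. -}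

module Defs where

open import Data.Bool using (Bool; true; false; not)
open import Data.List using (List; []; _∷_; _++_; [_])
open import Data.Nat using (ℕ; zero; suc)
open import Data.Product using (∃)
open import Relation.Binary.PropositionalEquality using (_≡_; refl)

-- Vertices of the regular rooted binary tree T: finite words over {0,1}
-- (letter 0 = false, letter 1 = true).  The children of v are v0, v1.
Word : Set
Word = List Bool

-- Ω = Aut(T): bijections of the vertex set fixing the root and mapping
-- children to children (hence preserving the tree structure).
-- The action is written as a function; (w)γ = fun γ w.
record Aut : Set where
  field
    fun   : Word → Word
    inv   : Word → Word
    inv-l : ∀ w → inv (fun w) ≡ w
    inv-r : ∀ w → fun (inv w) ≡ w
    root  : fun [] ≡ []
    child : ∀ v x → ∃ λ y → fun (v ++ [ x ]) ≡ fun v ++ [ y ]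
open Aut public

idA : Aut
idA = record
  { fun = λ w → w ; inv = λ w → w ; inv-l = λ _ → refl ; inv-r = λ _ → refl
  ; root = refl ; child = λ v x → x Data.Product., refl }

-- The root permutation τ ∈ {id, σ}: false = id, true = σ.
Perm : Set
Perm = Bool

idP σP : Perm
idP = false
σP  = true

actP : Perm → Bool → Bool
actP false x = x
actP true  x = not x

sec : Aut → Aut → Bool → Aut
sec g₀ g₁ false = g₀
sec g₀ g₁ true  = g₁

-- γ = (γ₀ , γ₁) τ   means  (x v)γ = (x)τ (v)γ_x  for all letters x, words v.
Decomp : Aut → Aut → Aut → Perm → Set
Decomp γ g₀ g₁ τ = ∀ x v → fun γ (x ∷ v) ≡ actP τ x ∷ fun (sec g₀ g₁ x) v

-- Right action of the product a₁ a₂ ⋯ aₖ ("first a₁, then a₂, ...")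
-- on a word w:  (w) a₁ a₂ ⋯ aₖ.
prodAct : (ℕ → Aut) → ℕ → Word → Word
prodAct a zero    w = w
prodAct a (suc k) w = fun (a (suc k)) (prodAct a k w)

-- On a word 1v the factors of a₁ ⋯ aᵣ only change the first letter: a₁ sends it to 0,
-- a₂ … a_{s-1} ignore 0-words, a_s sends it back to 1 and a_{s+1} … aᵣ ignore 1-words.
-- On a word 0v each aᵢ instead applies its non-trivial section a_{i-1} below the first
-- letter (a₁ contributing aᵣ), and the first letter returns to 0; so the section of
-- g = a₁ ⋯ aᵣ at 0 is aᵣ a₁ ⋯ a_{r-1}, the conjugate of g by aᵣ. Hence g fixes 0v iff
-- g fixes (v)aᵣ, a word of the same length as v, and induction on length finishes.
module Submission where

open import Defs
open import Data.Bool using (true; false)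
open import Data.List using ([]; _∷_; _++_; [_]; length)
open import Data.List.Properties using (++-assoc; ++-identityʳ; length-++)
open import Data.Nat using (ℕ; zero; suc; _≤_; _<_; _∸_; _+_; z≤n; s≤s)
open import Data.Nat.Properties
  using (+-assoc; +-comm; +-identityʳ; ≤-refl; ≤-pred; m≤n⇒m≤1+n; m≤n⇒m<n∨m≡n; suc-injective)
open import Data.Product using (_,_)
open import Data.Sum using (inj₁; inj₂)
open import Function.Definitions using (Injective)
open import Level using (Level)
open import Relation.Binary.PropositionalEquality
  using (_≡_; refl; sym; trans; cong; subst; module ≡-Reasoning)
open ≡-Reasoning

interval-induction : ∀ {ℓ : Level} (P : ℕ → Set ℓ) {j k : ℕ} →
                     (∀ {i} → j ≤ i → i < k → P i → P (suc i)) →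
                     j ≤ k → P j → P k
interval-induction P {k = zero}  step z≤n  Pj = Pj
interval-induction P {k = suc k} step j≤1+k Pj with m≤n⇒m<n∨m≡n j≤1+k
... | inj₂ refl      = Pj
... | inj₁ (s≤s j≤k) =
  step j≤k ≤-refl (interval-induction P (λ j≤i i<k → step j≤i (m≤n⇒m≤1+n i<k)) j≤k Pj)

fun-injective : (γ : Aut) → Injective _≡_ _≡_ (fun γ)
fun-injective γ {u} {v} eq = begin
  u                 ≡⟨ sym (inv-l γ u) ⟩
  inv γ (fun γ u)   ≡⟨ cong (inv γ) eq ⟩
  inv γ (fun γ v)   ≡⟨ inv-l γ v ⟩
  v                 ∎

length-fun-++ : (γ : Aut) (v u : Word) →
                length (fun γ (v ++ u)) ≡ length (fun γ v) + length u
length-fun-++ γ v [] = begin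
  length (fun γ (v ++ []))   ≡⟨ cong (λ w → length (fun γ w)) (++-identityʳ v) ⟩
  length (fun γ v)           ≡⟨ sym (+-identityʳ _) ⟩
  length (fun γ v) + 0       ∎
length-fun-++ γ v (x ∷ u) with child γ v x
... | y , γvx≡γvy = begin
  length (fun γ (v ++ x ∷ u))           ≡⟨ cong (λ w → length (fun γ w)) (sym (++-assoc v [ x ] u)) ⟩
  length (fun γ ((v ++ [ x ]) ++ u))    ≡⟨ length-fun-++ γ (v ++ [ x ]) u ⟩
  length (fun γ (v ++ [ x ])) + length u ≡⟨ cong (λ w → length w + length u) γvx≡γvy ⟩
  length (fun γ v ++ [ y ]) + length u  ≡⟨ cong (_+ length u) (length-++ (fun γ v)) ⟩
  length (fun γ v) + 1 + length u       ≡⟨ +-assoc (length (fun γ v)) 1 (length u) ⟩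
  length (fun γ v) + length (x ∷ u)     ∎

length-fun : (γ : Aut) (w : Word) → length (fun γ w) ≡ length w
length-fun γ w = trans (length-fun-++ γ [] w) (cong (λ v → length v + length w) (root γ))

fixes-all-if-section-conjugate :
  (γ : Aut) (g : Word → Word) →
  fun γ (g []) ≡ [] →
  (∀ v → fun γ (g (true ∷ v)) ≡ true ∷ v) →
  (∀ v → fun γ (g (false ∷ v)) ≡ false ∷ g (fun γ v)) →
  ∀ w → fun γ (g w) ≡ w
fixes-all-if-section-conjugate γ g fix-[] fix-1 section-0 w = fixes (length w) w refl
  where
  fixes : ∀ n w → length w ≡ n → fun γ (g w) ≡ w
  fixes _       []          _   = fix-[]
  fixes _       (true ∷ v)  _   = fix-1 v
  fixes (suc n) (false ∷ v) len = trans (section-0 v) (cong (false ∷_) g-γv≡v)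
    where
    g-γv≡v : g (fun γ v) ≡ v
    g-γv≡v = fun-injective γ (fixes n (fun γ v) (trans (length-fun γ v) (suc-injective len)))

module _ (a : ℕ → Aut) where

  prodAct-[] : ∀ k → prodAct a k [] ≡ []
  prodAct-[] zero    = refl
  prodAct-[] (suc k) = trans (cong (fun (a (suc k))) (prodAct-[] k)) (root (a (suc k)))

  prodAct-fixed : ∀ {j k w u} → j ≤ k →
                  (∀ {i} → j < i → i ≤ k → fun (a i) u ≡ u) →
                  prodAct a j w ≡ u → prodAct a k w ≡ u
  prodAct-fixed {w = w} {u} j≤k fixes =
    interval-induction (λ i → prodAct a i w ≡ u)
      (λ j≤i i<k eq → trans (cong (fun (a _)) eq) (fixes (s≤s j≤i) i<k)) j≤k

  prodAct-shift : ∀ x {j k w u} → j ≤ k →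
                  (∀ {i} → suc j < i → i ≤ suc k → ∀ y → fun (a i) (x ∷ y) ≡ x ∷ fun (a (i ∸ 1)) y) →
                  prodAct a (suc j) w ≡ x ∷ prodAct a j u →
                  prodAct a (suc k) w ≡ x ∷ prodAct a k u
  prodAct-shift x {w = w} {u} j≤k shifts =
    interval-induction (λ i → prodAct a (suc i) w ≡ x ∷ prodAct a i u)
      (λ j≤i i<k eq → trans (cong (fun (a _)) eq) (shifts (s≤s (s≤s j≤i)) (s≤s i<k) _)) j≤k

lemma4p5 : (r s : ℕ) → 3 ≤ r → 1 < s → s ≤ r → (a : ℕ → Aut)
    → Decomp (a 1) (a r) idA σP
    → (∀ i → 2 ≤ i → i ≤ s ∸ 1 → Decomp (a i) idA (a (i ∸ 1)) idP)
    → Decomp (a s) idA (a (s ∸ 1)) σP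
    → (∀ i → s + 1 ≤ i → i ≤ r → Decomp (a i) (a (i ∸ 1)) idA idP)
    → ∀ w → prodAct a r w ≡ w
lemma4p5 r@(suc r′) s@(suc (suc s″)) _ (s≤s (s≤s _)) s≤r a dec-1 dec-low dec-s dec-high =
  fixes-all-if-section-conjugate (a r) (prodAct a r′) (prodAct-[] a r) fix-1 section-0
  where
  dec-high′ : ∀ {i} → s < i → i ≤ r → Decomp (a i) (a (i ∸ 1)) idA idP
  dec-high′ {i} s<i = dec-high i (subst (_≤ i) (+-comm 1 s) s<i)

  fix-1 : ∀ v → prodAct a r (true ∷ v) ≡ true ∷ v
  fix-1 v = prodAct-fixed a s≤r (λ s<i i≤r → dec-high′ s<i i≤r true v) (begin
    prodAct a s (true ∷ v)  ≡⟨ cong (fun (a s)) (prodAct-fixed a (s≤s z≤n)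
                                 (λ 1<i i≤s-1 → dec-low _ 1<i i≤s-1 false v) (dec-1 true v)) ⟩
    fun (a s) (false ∷ v)   ≡⟨ dec-s false v ⟩
    true ∷ v                ∎)

  section-0 : ∀ v → prodAct a r (false ∷ v) ≡ false ∷ prodAct a r′ (fun (a r) v)
  section-0 v = prodAct-shift a false (≤-pred s≤r) (λ s<i i≤r → dec-high′ s<i i≤r false) (begin
    prodAct a s (false ∷ v)                     ≡⟨ cong (fun (a s)) (prodAct-shift a true z≤n
                                                     (λ 1<i i≤s-1 → dec-low _ 1<i i≤s-1 true) (dec-1 false v)) ⟩
    fun (a s) (true ∷ prodAct a s″ (fun (a r) v)) ≡⟨ dec-s true _ ⟩
    false ∷ prodAct a (suc s″) (fun (a r) v)     ∎)
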